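{- Let $n$ be a positive integer and $k \in \{0,1,\dots,n\}$. Let $\mathcal{Q}_{n,k} \subset \mathbb{R}^n$ be defined by $x_i \ge 0$ for $1 \le i \le n$, $x_i \le 1$ for $1 \le i \le k$, and $x_1 + \cdots + x_n \le n$, and let $h(\tau_{n,k},t) = \sum_{i=0}^n h_i t^i$, where $h_i$ is the number of points of $\mathcal{Q}_{n,k} \cap \mathbb{N}^n$ with exactly $i$ nonzero coordinates. Then $$ t^n h(\tau_{n,k},1/t) = \sum_{j=0}^n \sum_{i=0}^{n-k} \binom{n-k}{i}\binom{k}{j-i}\binom{n-k+j-i}{j} t^j. $$
   Context: $\mathbb{N} = \{0,1,2,\dots\}$; binomial coefficients $\binom{a}{b}$ are zero when $b<0$ or $b>a$. -}

module Defs where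

open import Data.Nat using (ℕ; zero; suc; _+_; _∸_; _≤_; _<_; _≟_; _≤?_; _<?_)
open import Data.Nat.Combinatorics using (_C_)
open import Data.Fin using (Fin; toℕ)
open import Data.Fin.Properties using (all?)
open import Data.List using (List; []; _∷_; map; concatMap; filter; length; upTo)
open import Data.Nat.ListAction using (sum)
open import Data.Vec as V using (Vec; []; _∷_; lookup; toList)
open import Data.Product using (_×_)
open import Relation.Nullary using (Dec; ¬_; yes; no)
open import Relation.Nullary.Decidable using (_×-dec_; _→-dec_; ¬?)

boxVecs : (m b : ℕ) → List (Vec ℕ m)
boxVecs zero    b = [] ∷ []
boxVecs (suc m) b = concatMap (λ a → map (a ∷_) (boxVecs m b)) (upTo (suc b))

nonzeros : ∀ {m} → Vec ℕ m → ℕ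
nonzeros x = length (filter (λ a → ¬? (a ≟ 0)) (toList x))

-- Membership of x ∈ ℕ^n in Q_{n,k}: x_i ≤ 1 for the first k coordinates
-- (0-based indices i < k), and x_1 + … + x_n ≤ n.  (x_i ≥ 0 is automatic in ℕ.)
InQ : (n k : ℕ) → Vec ℕ n → Set
InQ n k x = ((i : Fin n) → toℕ i < k → lookup x i ≤ 1) × (V.sum x ≤ n)

InQ? : (n k : ℕ) (x : Vec ℕ n) → Dec (InQ n k x)
InQ? n k x = all? (λ i → (toℕ i <? k) →-dec (lookup x i ≤? 1)) ×-dec (V.sum x ≤? n)

-- h_i = #{ x ∈ Q_{n,k} ∩ ℕ^n : x has exactly i nonzero coordinates }.
-- Every such x has all coordinates ≤ n (since their sum is ≤ n), so
-- enumerating {0,…,n}^n loses no points.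
hcoef : (n k i : ℕ) → ℕ
hcoef n k i = length (filter (λ x → InQ? n k x ×-dec (nonzeros x ≟ i)) (boxVecs n n))

binomDiff : (k j i : ℕ) → ℕ
binomDiff k j i with i ≤? j
... | yes _ = k C (j ∸ i)
... | no  _ = 0

rhsCoef : (n k j : ℕ) → ℕ
rhsCoef n k j =
  sum (map (λ i → ((n ∸ k) C i) Data.Nat.* (binomDiff k j i Data.Nat.* ((n ∸ k + j ∸ i) C j)))
           (upTo (suc (n ∸ k))))

{-# OPTIONS --safe #-}
-- Count the lattice points by their number w of zero coordinates, for the more general region
-- x ∈ ℕ^(k+p), x_i ≤ 1 for i < k, Σ x ≤ k + t.  While k > 0 the first coordinate is 0 or 1, and
-- deleting it leaves a point of the same kind for (k − 1, t + 1, w − 1), resp. (k − 1, t, w);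
-- this is Pascal's rule in k for C(k, w − i).  For k = 0 there are C(p, w) C(t, p − w) points:
-- choose the zero positions, then the p − w positive entries with sum ≤ t (hockey-stick identity).
-- Hence the count is Σ_i C(p, i) C(k, w − i) C(t + w − i, p − i), which for t = p and w = j is
-- the right-hand side.
module Submission where

open import Defs
open import Data.Nat
open import Data.Nat.Properties
open import Data.Nat.Combinatorics
open import Data.Nat.ListAction using (sum)
open import Data.Bool using (true; false)
open import Data.Fin using (Fin; toℕ) renaming (zero to fzero; suc to fsuc)
open import Data.Fin.Properties using (all?)
open import Data.List using (List; []; _∷_; _++_; map; filter; length; concatMap; applyUpTo)
open import Data.List.Properties using (filter-≐; filter-++; filter-none; length-++)
import Data.List.Relation.Unary.All as All
open import Data.Vec as V using (Vec; []; _∷_; lookup)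
open import Data.Product using (_×_; _,_)
open import Function using (_∘_)
open import Level using (Level)
open import Relation.Nullary using (¬_; does; yes; no; contradiction)
open import Relation.Nullary.Decidable using (_×-dec_; _→-dec_)
open import Relation.Unary using (Pred; Decidable; _≐_)
open import Relation.Binary.PropositionalEquality
open import Algebra.Properties.CommutativeSemigroup +-commutativeSemigroup using (interchange)

∑ : ℕ → (ℕ → ℕ) → ℕ
∑ zero    f = 0
∑ (suc n) f = f 0 + ∑ n (f ∘ suc)

syntax ∑ n (λ i → f) = ∑[ i < n ] f

private variable
  m n : ℕ
  f g : ℕ → ℕ

∑-cong : (∀ {i} → i < n → f i ≡ g i) → ∑ n f ≡ ∑ n g
∑-cong {zero}  f≡g = refl
∑-cong {suc n} f≡g = cong₂ _+_ (f≡g z<s) (∑-cong (f≡g ∘ s<s))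

∑-zero : (∀ {i} → i < n → f i ≡ 0) → ∑ n f ≡ 0
∑-zero {zero}  f≡0 = refl
∑-zero {suc n} f≡0 = cong₂ _+_ (f≡0 z<s) (∑-zero (f≡0 ∘ s<s))

∑-support : m ≤ n → (∀ {i} → m ≤ i → i < n → f i ≡ 0) → ∑ n f ≡ ∑ m f
∑-support z≤n       f≡0 = ∑-zero (f≡0 z≤n)
∑-support (s≤s m≤n) f≡0 = cong (_ +_) (∑-support m≤n (λ m≤i i<n → f≡0 (s≤s m≤i) (s<s i<n)))

∑-single : ∀ w → (∀ {i} → i ≢ w → f i ≡ 0) → (n ≤ w → f w ≡ 0) → ∑ n f ≡ f w
∑-single {n = zero} w f≡0 fw≡0 = sym (fw≡0 z≤n)
∑-single {f = f} {n = suc n} zero f≡0 fw≡0 =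
  trans (cong (f 0 +_) (∑-zero {n} (λ {i} _ → f≡0 {suc i} (λ ())))) (+-identityʳ (f 0))
∑-single {f = f} {n = suc n} (suc w) f≡0 fw≡0 =
  trans (cong (_+ ∑ n (f ∘ suc)) (f≡0 {0} (λ ())))
        (∑-single w (λ i≢w → f≡0 (i≢w ∘ suc-injective)) (fw≡0 ∘ s≤s))

∑-+ : ∀ n (f g : ℕ → ℕ) → ∑[ i < n ] (f i + g i) ≡ ∑ n f + ∑ n g
∑-+ zero    f g = refl
∑-+ (suc n) f g =
  trans (cong (f 0 + g 0 +_) (∑-+ n (f ∘ suc) (g ∘ suc))) (interchange (f 0) (g 0) _ _)

∑-*ˡ : ∀ n c → ∑[ i < n ] (c * f i) ≡ c * ∑ n f
∑-*ˡ zero    c = sym (*-zeroʳ c)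
∑-*ˡ (suc n) c = trans (cong (_ +_) (∑-*ˡ n c)) (sym (*-distribˡ-+ c _ _))

sum-map-applyUpTo : ∀ (g h : ℕ → ℕ) n → sum (map g (applyUpTo h n)) ≡ ∑[ i < n ] g (h i)
sum-map-applyUpTo g h zero    = refl
sum-map-applyUpTo g h (suc n) = cong (g (h 0) +_) (sum-map-applyUpTo g (h ∘ suc) n)

hockey-stick : ∀ s z → ∑[ a < s ] ((s ∸ suc a) C z) ≡ s C suc z
hockey-stick zero    z = refl
hockey-stick (suc s) z = trans (cong (s C z +_) (hockey-stick s z)) (nCk+nC[k+1]≡[n+1]C[k+1] s z)

[m+n]Cn≡[m+n]Cm : ∀ m n → (m + n) C n ≡ (m + n) C m
[m+n]Cn≡[m+n]Cm m n = trans (nCk≡nC[n∸k] (m≤n+m n m)) (cong ((m + n) C_) (m+n∸n≡m m n))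

pC[1+w]*tC[1+p∸[1+w]] : ∀ p w t →
                        (p C suc w) * (t C suc (p ∸ suc w)) ≡ (p C suc w) * (t C (p ∸ w))
pC[1+w]*tC[1+p∸[1+w]] p w t with w <? p
... | yes w<p = cong (λ e → (p C suc w) * (t C e)) (sym (+-∸-assoc 1 w<p))
... | no  w≮p rewrite k>n⇒nCk≡0 {p} {suc w} (s≤s (≮⇒≥ w≮p)) = refl

binomDiff-≤ : ∀ k {j i} → i ≤ j → binomDiff k j i ≡ k C (j ∸ i)
binomDiff-≤ k {j} {i} i≤j with i ≤? j
... | yes _   = refl
... | no  i≰j = contradiction i≤j i≰j

binomDiff-> : ∀ k {j i} → j < i → binomDiff k j i ≡ 0
binomDiff-> k {j} {i} j<i with i ≤? j
... | yes i≤j = contradiction i≤j (<⇒≱ j<i)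
... | no  _   = refl

binomDiff-suc : ∀ k j i → binomDiff k (suc j) (suc i) ≡ binomDiff k j i
binomDiff-suc k j i with i ≤? j
... | yes i≤j = binomDiff-≤ k (s≤s i≤j)
... | no  i≰j = binomDiff-> k (s<s (≰⇒> i≰j))

binomDiff-pascal₀ : ∀ k i → binomDiff (suc k) 0 i ≡ binomDiff k 0 i
binomDiff-pascal₀ k zero    = refl
binomDiff-pascal₀ k (suc i) = refl

binomDiff-pascal : ∀ k j i →
                   binomDiff (suc k) (suc j) i ≡ binomDiff k j i + binomDiff k (suc j) i
binomDiff-pascal k j       zero    = sym (nCk+nC[k+1]≡[n+1]C[k+1] k j)
binomDiff-pascal k zero    (suc i) =
  trans (binomDiff-suc (suc k) 0 i) (trans (binomDiff-pascal₀ k i) (sym (binomDiff-suc k 0 i)))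
binomDiff-pascal k (suc j) (suc i) = begin
  binomDiff (suc k) (suc (suc j)) (suc i)
    ≡⟨ binomDiff-suc (suc k) (suc j) i ⟩
  binomDiff (suc k) (suc j) i
    ≡⟨ binomDiff-pascal k j i ⟩
  binomDiff k j i + binomDiff k (suc j) i
    ≡⟨ cong₂ _+_ (binomDiff-suc k j i) (binomDiff-suc k (suc j) i) ⟨
  binomDiff k (suc j) (suc i) + binomDiff k (suc (suc j)) (suc i) ∎
  where open ≡-Reasoning

binomDiff-0≢ : ∀ {j i} → i ≢ j → binomDiff 0 j i ≡ 0
binomDiff-0≢ {j} {i} i≢j with i ≤? j
... | yes i≤j = k>n⇒nCk≡0 (m<n⇒0<n∸m (≤∧≢⇒< i≤j i≢j))
... | no  _   = refl

binomDiff-0-diag : ∀ j → binomDiff 0 j j ≡ 1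
binomDiff-0-diag j = trans (binomDiff-≤ 0 {j} ≤-refl) (cong (0 C_) (n∸n≡0 j))

-- i is the number of zeros among the last p coordinates, so w − i zeros lie among the first k,
-- and the p − i positive entries among the last p have sum at most r − i, where r = t + w.
qCount : (k p r w : ℕ) → ℕ
qCount k p r w = ∑[ i < suc p ] ((p C i) * (binomDiff k w i * ((r ∸ i) C (p ∸ i))))

qCount-pascal₀ : ∀ k p r → qCount (suc k) p r 0 ≡ qCount k p r 0
qCount-pascal₀ k p r =
  ∑-cong {suc p} (λ {i} _ → cong (λ b → (p C i) * (b * ((r ∸ i) C (p ∸ i))))
                                 (binomDiff-pascal₀ k i))

qCount-pascal : ∀ k p r w → qCount (suc k) p r (suc w) ≡ qCount k p r w + qCount k p r (suc w)
qCount-pascal k p r w =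
  trans (∑-cong {suc p} (λ {i} _ → split i)) (∑-+ (suc p) (term w) (term (suc w)))
  where
  term : ℕ → ℕ → ℕ
  term v i = (p C i) * (binomDiff k v i * ((r ∸ i) C (p ∸ i)))
  split : ∀ i → (p C i) * (binomDiff (suc k) (suc w) i * ((r ∸ i) C (p ∸ i)))
              ≡ term w i + term (suc w) i
  split i = begin
    (p C i) * (binomDiff (suc k) (suc w) i * X)
      ≡⟨ cong (λ b → (p C i) * (b * X)) (binomDiff-pascal k w i) ⟩
    (p C i) * ((binomDiff k w i + binomDiff k (suc w) i) * X)
      ≡⟨ cong ((p C i) *_) (*-distribʳ-+ X (binomDiff k w i) _) ⟩
    (p C i) * (binomDiff k w i * X + binomDiff k (suc w) i * X)
      ≡⟨ *-distribˡ-+ (p C i) _ _ ⟩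
    (p C i) * (binomDiff k w i * X) + (p C i) * (binomDiff k (suc w) i * X) ∎
    where
    open ≡-Reasoning
    X = (r ∸ i) C (p ∸ i)

qCount-base : ∀ p r w → qCount 0 p r w ≡ (p C w) * ((r ∸ w) C (p ∸ w))
qCount-base p r w = trans (∑-single w off-diagonal out-of-range) diagonal
  where
  term : ℕ → ℕ
  term i = (p C i) * (binomDiff 0 w i * ((r ∸ i) C (p ∸ i)))
  off-diagonal : ∀ {i} → i ≢ w → term i ≡ 0
  off-diagonal {i} i≢w rewrite binomDiff-0≢ i≢w = *-zeroʳ (p C i)
  out-of-range : suc p ≤ w → term w ≡ 0
  out-of-range p<w rewrite k>n⇒nCk≡0 p<w = refl
  diagonal : term w ≡ (p C w) * ((r ∸ w) C (p ∸ w))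
  diagonal rewrite binomDiff-0-diag w = cong ((p C w) *_) (+-identityʳ _)

count : ∀ {a ℓ} {A : Set a} {P : Pred A ℓ} → Decidable P → List A → ℕ
count P? = length ∘ filter P?

module _ {a ℓ : Level} {A : Set a} where
  private variable
    P Q : Pred A ℓ

  count-≐ : (P? : Decidable P) (Q? : Decidable Q) → P ≐ Q → ∀ xs → count P? xs ≡ count Q? xs
  count-≐ P? Q? P≐Q xs = cong length (filter-≐ P? Q? P≐Q xs)

  count-none : (P? : Decidable P) → (∀ x → ¬ P x) → ∀ xs → count P? xs ≡ 0
  count-none P? ¬P xs = cong length (filter-none P? (All.universal ¬P xs))

  count-++ : (P? : Decidable P) → ∀ xs ys → count P? (xs ++ ys) ≡ count P? xs + count P? ys
  count-++ P? xs ys = trans (cong length (filter-++ P? xs ys)) (length-++ (filter P? xs))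

  count-map : ∀ {b} {B : Set b} (P? : Decidable P) (h : B → A) →
              ∀ xs → count P? (map h xs) ≡ count (λ x → P? (h x)) xs
  count-map P? h []       = refl
  count-map P? h (x ∷ xs) with does (P? (h x))
  ... | true  = cong suc (count-map P? h xs)
  ... | false = count-map P? h xs

  count-concatMap : ∀ {b} {B : Set b} (P? : Decidable P) (h : B → List A) →
                    ∀ xs → count P? (concatMap h xs) ≡ sum (map (count P? ∘ h) xs)
  count-concatMap P? h []       = refl
  count-concatMap P? h (x ∷ xs) =
    trans (count-++ P? (h x) _) (cong (count P? (h x) +_) (count-concatMap P? h xs))

count-boxVecs : ∀ {ℓ m} b {P : Pred (Vec ℕ (suc m)) ℓ} (P? : Decidable P) →
                count P? (boxVecs (suc m) b) ≡ ∑[ a < suc b ] count (λ x → P? (a ∷ x)) (boxVecs m b)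
count-boxVecs {m = m} b P? = begin
  count P? (boxVecs (suc m) b)
    ≡⟨ count-concatMap P? (λ a → map (a ∷_) (boxVecs m b)) (applyUpTo (λ i → i) (suc b)) ⟩
  sum (map (λ a → count P? (map (a ∷_) (boxVecs m b))) (applyUpTo (λ i → i) (suc b)))
    ≡⟨ sum-map-applyUpTo _ (λ i → i) (suc b) ⟩
  ∑[ a < suc b ] count P? (map (a ∷_) (boxVecs m b))
    ≡⟨ ∑-cong {suc b} (λ {a} _ → count-map P? (a ∷_) (boxVecs m b)) ⟩
  ∑[ a < suc b ] count (λ x → P? (a ∷ x)) (boxVecs m b) ∎
  where open ≡-Reasoning

zeros : Vec ℕ m → ℕ
zeros []          = 0
zeros (zero  ∷ x) = suc (zeros x)
zeros (suc _ ∷ x) = zeros x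

nonzeros+zeros : (x : Vec ℕ m) → nonzeros x + zeros x ≡ m
nonzeros+zeros []          = refl
nonzeros+zeros (zero  ∷ x) = trans (+-suc (nonzeros x) (zeros x)) (cong suc (nonzeros+zeros x))
nonzeros+zeros (suc _ ∷ x) = cong suc (nonzeros+zeros x)

module _ {m j : ℕ} (x : Vec ℕ m) where

  nonzeros≡m∸j⇒zeros≡j : j ≤ m → nonzeros x ≡ m ∸ j → zeros x ≡ j
  nonzeros≡m∸j⇒zeros≡j j≤m eq = begin
    zeros x                           ≡⟨ m+n∸m≡n (nonzeros x) (zeros x) ⟨
    nonzeros x + zeros x ∸ nonzeros x ≡⟨ cong₂ _∸_ (nonzeros+zeros x) eq ⟩
    m ∸ (m ∸ j)                       ≡⟨ m∸[m∸n]≡n j≤m ⟩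
    j                                 ∎
    where open ≡-Reasoning

  zeros≡j⇒nonzeros≡m∸j : zeros x ≡ j → nonzeros x ≡ m ∸ j
  zeros≡j⇒nonzeros≡m∸j eq = begin
    nonzeros x                     ≡⟨ m+n∸n≡m (nonzeros x) (zeros x) ⟨
    nonzeros x + zeros x ∸ zeros x ≡⟨ cong₂ _∸_ (nonzeros+zeros x) eq ⟩
    m ∸ j                          ∎
    where open ≡-Reasoning

BinaryPrefix : ℕ → Vec ℕ m → Set
BinaryPrefix {m} k x = (i : Fin m) → toℕ i < k → lookup x i ≤ 1

binaryPrefix-zero : {x : Vec ℕ m} → BinaryPrefix 0 x
binaryPrefix-zero i ()

module _ {m a : ℕ} {x : Vec ℕ m} where

  binaryPrefix-head : ∀ {k} → BinaryPrefix (suc k) (a ∷ x) → a ≤ 1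
  binaryPrefix-head b = b fzero z<s

  binaryPrefix-tail : ∀ {k} → BinaryPrefix k (a ∷ x) → BinaryPrefix (pred k) x
  binaryPrefix-tail {k = suc k} b i i<k = b (fsuc i) (s<s i<k)

  binaryPrefix-∷ : ∀ {k} → a ≤ 1 → BinaryPrefix (pred k) x → BinaryPrefix k (a ∷ x)
  binaryPrefix-∷             a≤1 b fzero    _   = a≤1
  binaryPrefix-∷ {k = suc k} a≤1 b (fsuc i) i<k = b i (s<s⁻¹ i<k)

Q : ℕ → ℕ → ℕ → Vec ℕ m → Set
Q k s w x = (BinaryPrefix k x × V.sum x ≤ s) × zeros x ≡ w

Q? : ∀ k s w → Decidable (Q {m} k s w)
Q? k s w x =
  (all? (λ i → (toℕ i <? k) →-dec (lookup x i ≤? 1)) ×-dec (V.sum x ≤? s)) ×-dec (zeros x ≟ w)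

module _ {m : ℕ} (L : List (Vec ℕ m)) where

  count-Q-0∷ : ∀ k s w → count (λ x → Q? k s (suc w) (0 ∷ x)) L ≡ count (Q? (pred k) s w) L
  count-Q-0∷ k s w = count-≐ _ _
    ( (λ { ((b , σ) , ζ) → (binaryPrefix-tail b , σ) , suc-injective ζ })
    , (λ { ((b , σ) , ζ) → (binaryPrefix-∷ z≤n b , σ) , cong suc ζ }) ) L

  count-Q-0∷-no-zeros : ∀ k s → count (λ x → Q? k s 0 (0 ∷ x)) L ≡ 0
  count-Q-0∷-no-zeros k s = count-none _ (λ { _ (_ , ()) }) L

  count-Q-1∷ : ∀ k s w → count (λ x → Q? (suc k) (suc s) w (1 ∷ x)) L ≡ count (Q? k s w) L
  count-Q-1∷ k s w = count-≐ _ _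
    ( (λ { ((b , σ) , ζ) → (binaryPrefix-tail b , s≤s⁻¹ σ) , ζ })
    , (λ { ((b , σ) , ζ) → (binaryPrefix-∷ ≤-refl b , s≤s σ) , ζ }) ) L

  count-Q-2+∷ : ∀ k s w a → count (λ x → Q? (suc k) s w (2 + a ∷ x)) L ≡ 0
  count-Q-2+∷ k s w a = count-none _ (λ { _ ((b , _) , _) → 2+a≰1 (binaryPrefix-head b) }) L
    where
    2+a≰1 : ¬ 2 + a ≤ 1
    2+a≰1 (s≤s ())

  count-Q₀-suc∷ : ∀ {a s} w → a < s →
                  count (λ x → Q? 0 s w (suc a ∷ x)) L ≡ count (Q? 0 (s ∸ suc a) w) L
  count-Q₀-suc∷ {a} {s} w a<s = count-≐ _ _
    ( (λ { {x} ((_ , σ) , ζ) → (binaryPrefix-zero {x = x} , drop σ) , ζ })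
    , (λ { {x} ((_ , σ) , ζ) → (binaryPrefix-zero {x = suc a ∷ x} , restore σ) , ζ }) ) L
    where
    drop : ∀ {n} → suc a + n ≤ s → n ≤ s ∸ suc a
    drop {n} σ = subst (_≤ s ∸ suc a) (m+n∸m≡n (suc a) n) (∸-monoˡ-≤ (suc a) σ)
    restore : ∀ {n} → n ≤ s ∸ suc a → suc a + n ≤ s
    restore σ = ≤-trans (+-monoʳ-≤ (suc a) σ) (≤-reflexive (m+[n∸m]≡n a<s))

  count-Q₀-suc∷-large : ∀ {a s} w → s ≤ a → count (λ x → Q? 0 s w (suc a ∷ x)) L ≡ 0
  count-Q₀-suc∷-large w s≤a =
    count-none _ (λ { _ ((_ , σ) , _) → <⇒≱ (m+n≤o⇒m≤o _ σ) s≤a }) L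

count-Q₀ : ∀ {b} p t w → t ≤ b → count (Q? 0 t w) (boxVecs p b) ≡ (p C w) * (t C (p ∸ w))
count-Q₀     zero    t zero    _   = refl
count-Q₀     zero    t (suc w) _   = refl
count-Q₀ {b} (suc p) t w       t≤b = begin
  count (Q? 0 t w) (boxVecs (suc p) b)  ≡⟨ count-boxVecs {m = p} b (Q? 0 t w) ⟩
  c 0 + ∑[ a < b ] c (suc a)            ≡⟨ cong (c 0 +_) positive-head ⟩
  c 0 + (p C w) * (t C suc (p ∸ w))     ≡⟨ zero-head w ⟩
  (suc p C w) * (t C (suc p ∸ w))       ∎
  where
  open ≡-Reasoning
  L = boxVecs p b
  c : ℕ → ℕ
  c a = count (λ x → Q? 0 t w (a ∷ x)) L

  positive-head : ∑[ a < b ] c (suc a) ≡ (p C w) * (t C suc (p ∸ w))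
  positive-head = begin
    ∑[ a < b ] c (suc a)
      ≡⟨ ∑-support t≤b (λ t≤a _ → count-Q₀-suc∷-large L w t≤a) ⟩
    ∑[ a < t ] c (suc a)
      ≡⟨ ∑-cong {t} (λ {a} a<t → trans (count-Q₀-suc∷ L w a<t)
                                   (count-Q₀ p (t ∸ suc a) w (≤-trans (m∸n≤m t (suc a)) t≤b))) ⟩
    ∑[ a < t ] ((p C w) * ((t ∸ suc a) C (p ∸ w)))
      ≡⟨ ∑-*ˡ t (p C w) ⟩
    (p C w) * ∑[ a < t ] ((t ∸ suc a) C (p ∸ w))
      ≡⟨ cong ((p C w) *_) (hockey-stick t (p ∸ w)) ⟩
    (p C w) * (t C suc (p ∸ w))                    ∎

  zero-head : ∀ w → count (λ x → Q? 0 t w (0 ∷ x)) L + (p C w) * (t C suc (p ∸ w))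
                    ≡ (suc p C w) * (t C (suc p ∸ w))
  zero-head zero    = cong (_+ (p C 0) * (t C suc p)) (count-Q-0∷-no-zeros L 0 t)
  zero-head (suc w) = begin
    count (λ x → Q? 0 t (suc w) (0 ∷ x)) L + (p C suc w) * (t C suc (p ∸ suc w))
      ≡⟨ cong₂ _+_ (trans (count-Q-0∷ L 0 t w) (count-Q₀ p t w t≤b))
                   (pC[1+w]*tC[1+p∸[1+w]] p w t) ⟩
    (p C w) * (t C (p ∸ w)) + (p C suc w) * (t C (p ∸ w))
      ≡⟨ *-distribʳ-+ (t C (p ∸ w)) (p C w) (p C suc w) ⟨
    (p C w + p C suc w) * (t C (p ∸ w))
      ≡⟨ cong (_* (t C (p ∸ w))) (nCk+nC[k+1]≡[n+1]C[k+1] p w) ⟩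
    (suc p C suc w) * (t C (p ∸ w))                ∎

count-Q : ∀ {b} k p t w → k + t ≤ b →
          count (Q? k (k + t) w) (boxVecs (k + p) b) ≡ qCount k p (t + w) w
count-Q {b} zero p t w t≤b = begin
  count (Q? 0 t w) (boxVecs p b)     ≡⟨ count-Q₀ p t w t≤b ⟩
  (p C w) * (t C (p ∸ w))            ≡⟨ cong (λ s → (p C w) * (s C (p ∸ w))) (m+n∸n≡m t w) ⟨
  (p C w) * ((t + w ∸ w) C (p ∸ w))  ≡⟨ qCount-base p (t + w) w ⟨
  qCount 0 p (t + w) w               ∎
  where open ≡-Reasoning
count-Q {suc b} (suc k) p t w (s≤s k+t≤b) = begin
  count (Q? (suc k) (suc k + t) w) (boxVecs (suc k + p) (suc b))
    ≡⟨ count-boxVecs {m = k + p} (suc b) (Q? (suc k) (suc k + t) w) ⟩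
  c 0 + (c 1 + ∑[ a < b ] c (2 + a))
    ≡⟨ cong (c 0 +_) (cong₂ _+_ one-head (∑-zero {b} (λ {a} _ → count-Q-2+∷ L k _ w a))) ⟩
  c 0 + (qCount k p (t + w) w + 0)
    ≡⟨ cong (c 0 +_) (+-identityʳ _) ⟩
  c 0 + qCount k p (t + w) w
    ≡⟨ zero-head w ⟩
  qCount (suc k) p (t + w) w         ∎
  where
  open ≡-Reasoning
  L = boxVecs (k + p) (suc b)
  c : ℕ → ℕ
  c a = count (λ x → Q? (suc k) (suc k + t) w (a ∷ x)) L

  one-head : c 1 ≡ qCount k p (t + w) w
  one-head = trans (count-Q-1∷ L k (k + t) w) (count-Q k p t w (m≤n⇒m≤1+n k+t≤b))

  zero-head : ∀ w → count (λ x → Q? (suc k) (suc k + t) w (0 ∷ x)) L + qCount k p (t + w) w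
                    ≡ qCount (suc k) p (t + w) w
  zero-head zero    =
    trans (cong (_+ qCount k p (t + 0) 0) (count-Q-0∷-no-zeros L (suc k) (suc k + t)))
          (sym (qCount-pascal₀ k p (t + 0)))
  zero-head (suc w) = begin
    count (λ x → Q? (suc k) (suc k + t) (suc w) (0 ∷ x)) L + qCount k p (t + suc w) (suc w)
      ≡⟨ cong (_+ qCount k p (t + suc w) (suc w)) shifted ⟩
    qCount k p (suc t + w) w + qCount k p (t + suc w) (suc w)
      ≡⟨ cong (λ r → qCount k p r w + qCount k p (t + suc w) (suc w)) (+-suc t w) ⟨
    qCount k p (t + suc w) w + qCount k p (t + suc w) (suc w)
      ≡⟨ qCount-pascal k p (t + suc w) w ⟨
    qCount (suc k) p (t + suc w) (suc w) ∎
    where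
    shifted : count (λ x → Q? (suc k) (suc k + t) (suc w) (0 ∷ x)) L ≡ qCount k p (suc t + w) w
    shifted = begin
      count (λ x → Q? (suc k) (suc k + t) (suc w) (0 ∷ x)) L
        ≡⟨ count-Q-0∷ L (suc k) (suc k + t) w ⟩
      count (Q? k (suc k + t) w) L
        ≡⟨ cong (λ s → count (Q? k s w) L) (+-suc k t) ⟨
      count (Q? k (k + suc t) w) L
        ≡⟨ count-Q k p (suc t) w (subst (_≤ suc b) (sym (+-suc k t)) (s≤s k+t≤b)) ⟩
      qCount k p (suc t + w) w ∎

hcoef≡count-Q : ∀ {n j} k → j ≤ n → hcoef n k (n ∸ j) ≡ count (Q? k n j) (boxVecs n n)
hcoef≡count-Q {n} {j} k j≤n =
  count-≐ (λ x → InQ? n k x ×-dec (nonzeros x ≟ n ∸ j)) (Q? k n j)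
    ( (λ { {x} (inQ , eq) → inQ , nonzeros≡m∸j⇒zeros≡j x j≤n eq })
    , (λ { {x} (inQ , eq) → inQ , zeros≡j⇒nonzeros≡m∸j x eq }) )
    (boxVecs n n)

rhsCoef≡qCount : ∀ k p j → rhsCoef (k + p) k j ≡ qCount k p (p + j) j
rhsCoef≡qCount k p j = begin
  rhsCoef (k + p) k j
    ≡⟨ sum-map-applyUpTo (term (k + p ∸ k)) (λ i → i) (suc (k + p ∸ k)) ⟩
  ∑[ i < suc (k + p ∸ k) ] term (k + p ∸ k) i
    ≡⟨ cong (λ q → ∑[ i < suc q ] term q i) (m+n∸m≡n k p) ⟩
  ∑[ i < suc p ] term p i
    ≡⟨ ∑-cong {suc p} (λ {i} i≤p → cong (λ c → (p C i) * (binomDiff k j i * c))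
                                         (swap (s≤s⁻¹ i≤p))) ⟩
  qCount k p (p + j) j ∎
  where
  open ≡-Reasoning
  term : ℕ → ℕ → ℕ
  term q i = (q C i) * (binomDiff k j i * ((q + j ∸ i) C j))
  swap : ∀ {i} → i ≤ p → (p + j ∸ i) C j ≡ (p + j ∸ i) C (p ∸ i)
  swap i≤p rewrite +-∸-comm j i≤p = [m+n]Cn≡[m+n]Cm _ j

lemma2p1 : (n : ℕ) → 1 ≤ n → (k : ℕ) → k ≤ n → (j : ℕ) → j ≤ n →
           hcoef n k (n ∸ j) ≡ rhsCoef n k j
lemma2p1 n _ k k≤n j j≤n with m≤n⇒∃[o]m+o≡n k≤n
... | p , refl = begin
  hcoef (k + p) k (k + p ∸ j)                      ≡⟨ hcoef≡count-Q k j≤n ⟩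
  count (Q? k (k + p) j) (boxVecs (k + p) (k + p)) ≡⟨ count-Q k p p j ≤-refl ⟩
  qCount k p (p + j) j                             ≡⟨ rhsCoef≡qCount k p j ⟨
  rhsCoef (k + p) k j                              ∎
  where open ≡-Reasoning
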